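{- Let $R$ be a finite ring with unity and $\alpha,x\in R$. If $(x)_\ell=(x)_\ell\cap\langle\alpha\rangle^\perp$, then $C_\alpha(x)=|[x]_\ell|$.
   Context: Rings are associative with unity, not necessarily commutative. $(x)_\ell$ is the left ideal generated by $x$ and $[x]_\ell=\{y\in R:(y)_\ell=(x)_\ell\}$. Identify $(R,+)$ with $\mathbb{Z}_{n_1}\times\cdots\times\mathbb{Z}_{n_k}$, write $x=(x_1,\dots,x_k)$, and for $\alpha\in R$ let $\psi_\alpha(x)=\prod_{j=1}^k\omega_{n_j}^{\alpha_jx_j}$ with $\omega_n=e^{2\pi i/n}$. Define $C_\alpha(x)=\sum_{s\in[x]_\ell}\psi_\alpha(s)$. $\langle\alpha\rangle$ is the cyclic additive subgroup generated by $\alpha$, and $S^\perp=\{y\in R:\psi_s(y)=1\ \forall s\in S\}$. -}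

module Defs where

open import Data.Nat using (ℕ; zero; suc; _+_; _*_; NonZero)
open import Data.Nat.Properties using (m*n≢0)
open import Data.Nat.DivMod using (_%_; _/_; m%n<n)
open import Data.Fin using (Fin; toℕ; fromℕ<)
import Data.Fin.Properties as FinP
open import Data.List using (List; []; _∷_; [_]; map; concatMap; allFin; filter; length)
open import Data.Unit using (⊤; tt)
open import Data.Product using (Σ; ∃; _×_; _,_; proj₁; proj₂)
open import Relation.Nullary using (Dec; yes; no; ¬_)
open import Relation.Nullary.Decidable using (map′; _×-dec_; _→-dec_)
open import Relation.Binary.PropositionalEquality using (_≡_; refl; cong₂)
open import Data.Bool using (Bool; if_then_else_)
open import Data.Nat using (_≡ᵇ_)

-- The additive group  Z_{n_1} × ⋯ × Z_{n_k}.
-- A list of moduli is given as  ms = (m_1 ∷ … ∷ m_k),  with n_j = suc m_j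
-- (moduli are ≥ 1; a modulus 1 contributes a trivial factor).

El : List ℕ → Set
El []       = ⊤
El (m ∷ ms) = Fin (suc m) × El ms

_+ₘ_ : ∀ {m} → Fin (suc m) → Fin (suc m) → Fin (suc m)
_+ₘ_ {m} a b = fromℕ< (m%n<n (toℕ a + toℕ b) (suc m))

_⊕_ : ∀ {ms} → El ms → El ms → El ms
_⊕_ {[]}     _       _       = tt
_⊕_ {m ∷ ms} (a , x) (b , y) = (a +ₘ b) , (x ⊕ y)

zeroEl : ∀ {ms} → El ms
zeroEl {[]}     = tt
zeroEl {m ∷ ms} = Fin.zero , zeroEl

_·_ : ∀ {ms} → ℕ → El ms → El ms
zero  · α = zeroEl
suc c · α = α ⊕ (c · α)

-- A finite ring (associative, with unity, not necessarily commutative)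
-- whose additive group is Z_{n_1} × ⋯ × Z_{n_k}.

record RingOn (ms : List ℕ) : Set where
  infixl 7 _⊛_
  field
    _⊛_         : El ms → El ms → El ms
    one         : El ms
    *-assoc     : ∀ a b c → (a ⊛ b) ⊛ c ≡ a ⊛ (b ⊛ c)
    *-identityˡ : ∀ a → one ⊛ a ≡ a
    *-identityʳ : ∀ a → a ⊛ one ≡ a
    distribˡ    : ∀ a b c → a ⊛ (b ⊕ c) ≡ (a ⊛ b) ⊕ (a ⊛ c)
    distribʳ    : ∀ a b c → (b ⊕ c) ⊛ a ≡ (b ⊛ a) ⊕ (c ⊛ a)

allEl : ∀ ms → List (El ms)
allEl []       = [ tt ]
allEl (m ∷ ms) = concatMap (λ i → map (i ,_) (allEl ms)) (allFin (suc m))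

_≟El_ : ∀ {ms} (a b : El ms) → Dec (a ≡ b)
_≟El_ {[]}     tt tt = yes refl
_≟El_ {m ∷ ms} (a , x) (b , y) =
  map′ (λ { (p , q) → cong₂ _,_ p q }) (λ { refl → refl , refl })
       ((a FinP.≟ b) ×-dec (x ≟El y))

anyEl? : ∀ ms {P : El ms → Set} → (∀ a → Dec (P a)) → Dec (∃ P)
anyEl? []       P? with P? tt
... | yes p = yes (tt , p)
... | no ¬p = no λ { (tt , p) → ¬p p }
anyEl? (m ∷ ms) P? =
  map′ (λ { (i , a , p) → (i , a) , p }) (λ { ((i , a) , p) → i , a , p })
       (FinP.any? (λ i → anyEl? ms (λ a → P? (i , a))))

allEl? : ∀ ms {P : El ms → Set} → (∀ a → Dec (P a)) → Dec (∀ a → P a)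
allEl? []       P? with P? tt
... | yes p = yes λ { tt → p }
... | no ¬p = no λ h → ¬p (h tt)
allEl? (m ∷ ms) P? =
  map′ (λ h → λ { (i , a) → h i a }) (λ h i a → h (i , a))
       (FinP.all? (λ i → allEl? ms (λ a → P? (i , a))))

-- N = n_1 ⋯ n_k.  Every value ψ_a(y) = ∏_j ω_{n_j}^{a_j y_j}
-- is an N-th root of unity ω_N^e with
--   e = Σ_j a_j y_j (N / n_j)   (mod N),
-- so ψ_a(y) is represented exactly by its exponent e ∈ Z_N.

Nmod : List ℕ → ℕ
Nmod []       = 1
Nmod (m ∷ ms) = suc m * Nmod ms

Nmod-nonZero : ∀ ms → NonZero (Nmod ms)
Nmod-nonZero []       = _
Nmod-nonZero (m ∷ ms) = m*n≢0 (suc m) (Nmod ms) {{_}} {{Nmod-nonZero ms}}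

rawExp : ∀ ms → ℕ → El ms → El ms → ℕ
rawExp []       N _       _       = 0
rawExp (m ∷ ms) N (a , x) (b , y) = toℕ a * toℕ b * (N / suc m) + rawExp ms N x y

psiExp : ∀ {ms} → El ms → El ms → Fin (Nmod ms)
psiExp {ms} a y = fromℕ< (m%n<n (rawExp ms (Nmod ms) a y) (Nmod ms) {{Nmod-nonZero ms}})

ψ≡1 : ∀ {ms} → El ms → El ms → Set
ψ≡1 a y = toℕ (psiExp a y) ≡ 0

module _ {ms : List ℕ} (R : RingOn ms) where
  open RingOn R

  -- y ∈ (x)_ℓ  (the left ideal generated by x is R x, R having unity)
  InLeftIdeal : El ms → El ms → Set
  InLeftIdeal x y = ∃ λ r → r ⊛ x ≡ y

  inLeftIdeal? : ∀ x y → Dec (InLeftIdeal x y)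
  inLeftIdeal? x y = anyEl? ms (λ r → (r ⊛ x) ≟El y)

  SameIdeal : El ms → El ms → Set
  SameIdeal x y = ∀ z → (InLeftIdeal y z → InLeftIdeal x z) × (InLeftIdeal x z → InLeftIdeal y z)

  sameIdeal? : ∀ x y → Dec (SameIdeal x y)
  sameIdeal? x y = allEl? ms (λ z →
    (inLeftIdeal? y z →-dec inLeftIdeal? x z) ×-dec (inLeftIdeal? x z →-dec inLeftIdeal? y z))

  classList : El ms → List (El ms)
  classList x = filter (sameIdeal? x) (allEl ms)

  classCard : El ms → ℕ
  classCard x = length (classList x)

  -- C_α(x) = Σ_{s ∈ [x]_ℓ} ψ_α(s), as an element of the group ring ℕ[Z_N]
  -- (coefficient of ω_N^t, i.e. number of s ∈ [x]_ℓ with ψ_α(s) = ω_N^t)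
  Ramanujan : El ms → El ms → Fin (Nmod ms) → ℕ
  Ramanujan α x t = length (filter (λ s → psiExp α s FinP.≟ t) (classList x))

InPerpCyclic : ∀ {ms} → El ms → El ms → Set
InPerpCyclic α y = ∀ (c : ℕ) → ψ≡1 (c · α) y

intGR : ∀ {N} → ℕ → Fin N → ℕ
intGR n t = if toℕ t ≡ᵇ 0 then n else 0

{-# OPTIONS --safe #-}
module Submission where

-- Every s ∈ [x]ℓ satisfies s = 1 s ∈ (s)ℓ = (x)ℓ ⊆ ⟨α⟩^⊥, so in particular
-- ψ_α(s) = 1 (take the multiple 1·α = α of α). Thus each of the |[x]ℓ| terms
-- of C_α(x) equals 1.

open import Defs
open import Data.Nat using (ℕ; zero; suc; _+_)
open import Data.Nat.Properties using (+-identityʳ; 0≢1+n)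
open import Data.Nat.DivMod using (_%_; m<n⇒m%n≡m)
open import Data.List using (List; []; _∷_; filter; length)
open import Data.List.Properties using (filter-all; filter-none)
open import Data.List.Relation.Unary.All as All using (All)
open import Data.List.Relation.Unary.All.Properties using (all-filter)
open import Data.Fin using (Fin; toℕ)
import Data.Fin.Properties as FinP
open import Data.Product using (_×_; _,_; proj₁; proj₂)
open import Relation.Binary.PropositionalEquality
  using (_≡_; refl; sym; trans; cong; cong₂; subst; module ≡-Reasoning)

+ₘ-identityʳ : ∀ {m} (a : Fin (suc m)) → a +ₘ Fin.zero ≡ a
+ₘ-identityʳ {m} a = FinP.toℕ-injective (begin
  toℕ (a +ₘ Fin.zero)      ≡⟨ FinP.toℕ-fromℕ< _ ⟩
  (toℕ a + 0) % suc m      ≡⟨ cong (_% suc m) (+-identityʳ (toℕ a)) ⟩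
  toℕ a % suc m            ≡⟨ m<n⇒m%n≡m (FinP.toℕ<n a) ⟩
  toℕ a                    ∎)
  where open ≡-Reasoning

⊕-identityʳ : ∀ {ms} (a : El ms) → a ⊕ zeroEl ≡ a
⊕-identityʳ {[]}     _       = refl
⊕-identityʳ {m ∷ ms} (a , x) = cong₂ _,_ (+ₘ-identityʳ a) (⊕-identityʳ x)

·-identityˡ : ∀ {ms} (α : El ms) → 1 · α ≡ α
·-identityˡ = ⊕-identityʳ

perpCyclic⇒ψ≡1 : ∀ {ms} (α y : El ms) → InPerpCyclic α y → ψ≡1 α y
perpCyclic⇒ψ≡1 α y perp = subst (λ a → ψ≡1 a y) (·-identityˡ α) (perp 1)

sameIdeal⇒inLeftIdeal : ∀ {ms} (R : RingOn ms) {x s : El ms} →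
  SameIdeal R x s → InLeftIdeal R x s
sameIdeal⇒inLeftIdeal R {s = s} same = proj₁ (same s) (one , *-identityˡ s)
  where open RingOn R

classList-sameIdeal : ∀ {ms} (R : RingOn ms) (x : El ms) →
  All (SameIdeal R x) (classList R x)
classList-sameIdeal {ms} R x = all-filter (sameIdeal? R x) (allEl ms)

length-filter-≟-allZero : ∀ {A : Set} {N} (f : A → Fin N) (t : Fin N) (xs : List A) →
  All (λ a → toℕ (f a) ≡ 0) xs →
  length (filter (λ a → f a FinP.≟ t) xs) ≡ intGR (length xs) t
length-filter-≟-allZero f t xs zeros with toℕ t in t≡
... | zero  = cong length (filter-all (λ a → f a FinP.≟ t)
                (All.map (λ fa≡0 → FinP.toℕ-injective (trans fa≡0 (sym t≡))) zeros))
... | suc _ = cong length (filter-none (λ a → f a FinP.≟ t)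
                (All.map (λ fa≡0 fa≡t → 0≢1+n (trans (sym fa≡0) (trans (cong toℕ fa≡t) t≡))) zeros))

lemma4p3 : (ms : List ℕ) (R : RingOn ms) (α x : El ms) →
    (∀ y → (InLeftIdeal R x y → InLeftIdeal R x y × InPerpCyclic α y)
         × (InLeftIdeal R x y × InPerpCyclic α y → InLeftIdeal R x y)) →
    ∀ (t : Fin (Nmod ms)) → Ramanujan R α x t ≡ intGR (classCard R x) t
lemma4p3 ms R α x ideal⊆perp t =
  length-filter-≟-allZero (psiExp α) t (classList R x)
    (All.map ψα≡1 (classList-sameIdeal R x))
  where
  ψα≡1 : ∀ {s} → SameIdeal R x s → ψ≡1 α s
  ψα≡1 {s} same =
    perpCyclic⇒ψ≡1 α s (proj₂ (proj₁ (ideal⊆perp s) (sameIdeal⇒inLeftIdeal R same)))
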